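{- Let $\mathcal{S}$ be the variety of $2$-semilattices, whose similarity type consists of a single binary operation symbol $\cdot$. Every binary term $t(x,y)$ in this type which depends on both of its variables satisfies $\mathcal{S}\models t(x,y)\approx x\cdot y$.
   Context: $\mathcal{S}$ is the variety defined by the identities $x\cdot x\approx x$, $x\cdot y\approx y\cdot x$, $x\cdot(x\cdot y)\approx x\cdot y$. -}

module Defs where

open import Level using (Level)
open import Data.Fin using (Fin; zero; suc)
open import Algebra.Bundles using (Magma)
open import Data.Product using (_×_)

data Term₂ : Set where
  var : Fin 2 → Term₂
  _·_ : Term₂ → Term₂ → Term₂

x y : Term₂
x = var zero
y = var (suc zero)

data Occurs (i : Fin 2) : Term₂ → Set where
  here  : Occurs i (var i)
  left  : ∀ {s t} → Occurs i s → Occurs i (s · t)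
  right : ∀ {s t} → Occurs i t → Occurs i (s · t)

DependsOnBoth : Term₂ → Set
DependsOnBoth t = Occurs zero t × Occurs (suc zero) t

module _ {c ℓ : Level} (M : Magma c ℓ) where
  open Magma M

  ⟦_⟧ : Term₂ → (Fin 2 → Carrier) → Carrier
  ⟦ var i ⟧ ρ = ρ i
  ⟦ s · t ⟧ ρ = ⟦ s ⟧ ρ ∙ ⟦ t ⟧ ρ

  Satisfies : Term₂ → Term₂ → Set (c Level.⊔ ℓ)
  Satisfies s t = ∀ (ρ : Fin 2 → Carrier) → ⟦ s ⟧ ρ ≈ ⟦ t ⟧ ρ

  record Is2Semilattice : Set (c Level.⊔ ℓ) where
    field
      idem   : ∀ a → a ∙ a ≈ a
      comm   : ∀ a b → a ∙ b ≈ b ∙ a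
      absorb : ∀ a b → a ∙ (a ∙ b) ≈ a ∙ b

module Submission where

open import Defs
open import Algebra.Bundles using (Magma)
open import Data.Fin using (Fin; zero; suc)
open import Data.Product using (_,_)
open import Relation.Binary.PropositionalEquality using (_≡_; cong) renaming (refl to ≡-refl)
import Relation.Binary.Reasoning.Setoid as SetoidReasoning

-- In a 2-semilattice the elements a, b, a·b are closed under · with a fixed
-- multiplication table, so every binary term evaluates to one of them, and
-- which one depends only on the set of variables occurring in it.

-- The three nonempty subsets {x}, {y}, {x, y} of the variables, under union.
data Support : Set where
  X Y XY : Support

_∪_ : Support → Support → Support
X  ∪ X  = X
Y  ∪ Y  = Y
X  ∪ Y  = XY
Y  ∪ X  = XY
X  ∪ XY = XY
Y  ∪ XY = XY
XY ∪ _  = XY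

data _∈_ : Fin 2 → Support → Set where
  x∈X  : zero ∈ X
  x∈XY : zero ∈ XY
  y∈Y  : suc zero ∈ Y
  y∈XY : suc zero ∈ XY

∈-∪ˡ : ∀ {i} c d → i ∈ c → i ∈ (c ∪ d)
∈-∪ˡ X X  x∈X  = x∈X
∈-∪ˡ X Y  x∈X  = x∈XY
∈-∪ˡ X XY x∈X  = x∈XY
∈-∪ˡ Y X  y∈Y  = y∈XY
∈-∪ˡ Y Y  y∈Y  = y∈Y
∈-∪ˡ Y XY y∈Y  = y∈XY
∈-∪ˡ XY _ x∈XY = x∈XY
∈-∪ˡ XY _ y∈XY = y∈XY

∈-∪ʳ : ∀ {i} c d → i ∈ d → i ∈ (c ∪ d)
∈-∪ʳ X  X  x∈X  = x∈X
∈-∪ʳ Y  X  x∈X  = x∈XY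
∈-∪ʳ XY X  x∈X  = x∈XY
∈-∪ʳ X  Y  y∈Y  = y∈XY
∈-∪ʳ Y  Y  y∈Y  = y∈Y
∈-∪ʳ XY Y  y∈Y  = y∈XY
∈-∪ʳ X  XY p    = p
∈-∪ʳ Y  XY p    = p
∈-∪ʳ XY XY p    = p

x∈∧y∈⇒XY : ∀ {c} → zero ∈ c → suc zero ∈ c → c ≡ XY
x∈∧y∈⇒XY x∈XY _ = ≡-refl

support : Term₂ → Support
support (var zero)       = X
support (var (suc zero)) = Y
support (s · t)          = support s ∪ support t

occurs⇒∈support : ∀ {i t} → Occurs i t → i ∈ support t
occurs⇒∈support {zero}     here = x∈X
occurs⇒∈support {suc zero} here = y∈Y
occurs⇒∈support (left  {s} {t} o) = ∈-∪ˡ (support s) (support t) (occurs⇒∈support o)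
occurs⇒∈support (right {s} {t} o) = ∈-∪ʳ (support s) (support t) (occurs⇒∈support o)

dependsOnBoth⇒support≡XY : ∀ t → DependsOnBoth t → support t ≡ XY
dependsOnBoth⇒support≡XY t (x∈t , y∈t) =
  x∈∧y∈⇒XY (occurs⇒∈support x∈t) (occurs⇒∈support y∈t)

module TwoSemilattice {c ℓ} (M : Magma c ℓ) (S : Is2Semilattice M) where
  open Magma M
  open Is2Semilattice S
  open SetoidReasoning setoid

  absorbʳ : ∀ a b → b ∙ (a ∙ b) ≈ a ∙ b
  absorbʳ a b = begin
    b ∙ (a ∙ b) ≈⟨ ∙-cong refl (comm a b) ⟩
    b ∙ (b ∙ a) ≈⟨ absorb b a ⟩
    b ∙ a       ≈⟨ comm b a ⟩
    a ∙ b       ∎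

  ⟪_,_⟫ : Carrier → Carrier → Support → Carrier
  ⟪ a , b ⟫ X  = a
  ⟪ a , b ⟫ Y  = b
  ⟪ a , b ⟫ XY = a ∙ b

  ⟪⟫-homo : ∀ a b c d → ⟪ a , b ⟫ c ∙ ⟪ a , b ⟫ d ≈ ⟪ a , b ⟫ (c ∪ d)
  ⟪⟫-homo a b X  X  = idem a
  ⟪⟫-homo a b Y  Y  = idem b
  ⟪⟫-homo a b X  Y  = refl
  ⟪⟫-homo a b Y  X  = comm b a
  ⟪⟫-homo a b X  XY = absorb a b
  ⟪⟫-homo a b Y  XY = absorbʳ a b
  ⟪⟫-homo a b XY X  = trans (comm (a ∙ b) a) (absorb a b)
  ⟪⟫-homo a b XY Y  = trans (comm (a ∙ b) b) (absorbʳ a b)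
  ⟪⟫-homo a b XY XY = idem (a ∙ b)

  ⟦⟧≈⟪support⟫ : ∀ t ρ → ⟦ M ⟧ t ρ ≈ ⟪ ρ zero , ρ (suc zero) ⟫ (support t)
  ⟦⟧≈⟪support⟫ (var zero)       ρ = refl
  ⟦⟧≈⟪support⟫ (var (suc zero)) ρ = refl
  ⟦⟧≈⟪support⟫ (s · t)          ρ =
    trans (∙-cong (⟦⟧≈⟪support⟫ s ρ) (⟦⟧≈⟪support⟫ t ρ))
          (⟪⟫-homo (ρ zero) (ρ (suc zero)) (support s) (support t))

proposition4p3 : (t : Term₂) → DependsOnBoth t →
    ∀ {c ℓ} (M : Magma c ℓ) → Is2Semilattice M → Satisfies M t (x · y)
proposition4p3 t dep M S ρ = begin
  ⟦ M ⟧ t ρ                  ≈⟨ ⟦⟧≈⟪support⟫ t ρ ⟩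
  ⟪ a , b ⟫ (support t)      ≡⟨ cong ⟪ a , b ⟫ (dependsOnBoth⇒support≡XY t dep) ⟩
  a ∙ b                      ∎
  where
    open Magma M
    open TwoSemilattice M S
    open SetoidReasoning setoid
    a = ρ zero
    b = ρ (suc zero)
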